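{- Let $H \neq K_q^+$ be a constraint graph. If $H$ has at least one self-loop, then $H$ is identifiable. If $H$ has no self-loops, then $H$ is identifiable if and only if for each edge $\{i,j\}\in E(H)$ there exists an $H$-coloring $\sigma$ of the graph $G_{ij}$ such that $\sigma(i')$ and $\sigma(j')$ are incompatible colors in $H$ (i.e. $\{\sigma(i'),\sigma(j')\}\notin E(H)$).
   Context: A constraint graph $H$ is an undirected connected graph with vertex set $V(H)=\{1,\dots,q\}$ (called colors), possibly with self-loops but no parallel edges. $K_q^+$ denotes the complete graph on $q$ vertices with a self-loop at every vertex. Two colors $i,j$ are compatible if $\{i,j\}\in E(H)$ and incompatible otherwise. An $H$-coloring of a finite graph $G=(V,E)$ is a map $\sigma:V\to V(H)$ such that $\{\sigma(v),\sigma(w)\}\in E(H)$ for every $\{v,w\}\in E$; $G$ is $H$-colorable if one exists. $\Omega_G$ is the set of $H$-colorings of $G$ and $\pi_G$ the uniform distribution on $\Omega_G$. $H$ is identifiable if for any two distinct finite $H$-colorable graphs $G_1,G_2$ (on the same vertex set) we have $\pi_{G_1}\neq\pi_{G_2}$ (equivalently $\Omega_{G_1}\neq\Omega_{G_2}$). For $H$ with no self-loops and $\{i,j\}\in E(H)$, the graph $G_{ij}$ has vertex set $V(H)\cup\{i',j'\}$ with two new vertices $i',j'$; every edge of $H$ is an edge of $G_{ij}$; for each $k\in V(H)$, $\{i',k\}\in E(G_{ij})$ iff $\{i,k\}\in E(H)$ and $\{j',k\}\in E(G_{ij})$ iff $\{j,k\}\in E(H)$; there are no other edges (in particular $\{i',j'\}\notin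 E(G_{ij})$). -}

module Defs where

open import Data.Nat using (ℕ)
open import Data.Fin using (Fin)
open import Data.Bool using (Bool; true; false; _∧_)
open import Data.Product using (Σ; ∃; _×_)
open import Relation.Binary.PropositionalEquality using (_≡_)
open import Relation.Nullary using (¬_)
open import Function.Bundles using (_⇔_)

data Reachable {q : ℕ} (A : Fin q → Fin q → Bool) (i : Fin q) : Fin q → Set where
  here : Reachable A i i
  step : ∀ {j k} → Reachable A i j → A j k ≡ true → Reachable A i k

record ConstraintGraph (q : ℕ) : Set where
  field
    Adj       : Fin q → Fin q → Bool
    symmetric : ∀ i j → Adj i j ≡ Adj j i
    connected : ∀ i j → Reachable Adj i j
open ConstraintGraph public

IsKqPlus : ∀ {q} → ConstraintGraph q → Set
IsKqPlus H = ∀ i j → Adj H i j ≡ true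

HasSelfLoop : ∀ {q} → ConstraintGraph q → Set
HasSelfLoop H = ∃ λ i → Adj H i i ≡ true

NoSelfLoops : ∀ {q} → ConstraintGraph q → Set
NoSelfLoops H = ∀ i → Adj H i i ≡ false

IsHColoring : ∀ {q} {V : Set} → ConstraintGraph q → (V → V → Bool) → (V → Fin q) → Set
IsHColoring H E σ = ∀ v w → E v w ≡ true → Adj H (σ v) (σ w) ≡ true

record Graph (n : ℕ) : Set where
  field
    E     : Fin n → Fin n → Bool
    Esym  : ∀ u v → E u v ≡ E v u
    Eirr  : ∀ v → E v v ≡ false
open Graph public

Ω : ∀ {q n} → ConstraintGraph q → Graph n → (Fin n → Fin q) → Set
Ω H G σ = IsHColoring H (E G) σ

HColorable : ∀ {q n} → ConstraintGraph q → Graph n → Set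
HColorable H G = ∃ λ σ → Ω H G σ

Identifiable : ∀ {q} → ConstraintGraph q → Set
Identifiable H = ∀ n (G₁ G₂ : Graph n) → HColorable H G₁ → HColorable H G₂ →
  ¬ (∀ u v → E G₁ u v ≡ E G₂ u v) →
  ¬ (∀ σ → Ω H G₁ σ ⇔ Ω H G₂ σ)

-- The gadget graph G_ij: vertices V(H) ∪ {i', j'}.
data GV (q : ℕ) : Set where
  old  : Fin q → GV q
  newi : GV q
  newj : GV q

Gij : ∀ {q} → ConstraintGraph q → Fin q → Fin q → GV q → GV q → Bool
Gij H i j (old k) (old l) = Adj H k l
Gij H i j (old k) newi    = Adj H i k
Gij H i j (old k) newj    = Adj H j k
Gij H i j newi    (old k) = Adj H i k
Gij H i j newj    (old k) = Adj H j k
Gij H i j newi    newi    = false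
Gij H i j newi    newj    = false
Gij H i j newj    newi    = false
Gij H i j newj    newj    = false

GadgetCondition : ∀ {q} → ConstraintGraph q → Set
GadgetCondition H = ∀ i j → Adj H i j ≡ true →
  ∃ λ (σ : GV _ → Fin _) → IsHColoring H (Gij H i j) σ × Adj H (σ newi) (σ newj) ≡ false

-- Call H separable if every non-edge {u,v} of an H-colorable graph G is
-- witnessed by an H-coloring of G giving u and v incompatible colors; then the
-- edge sets of two graphs are determined by their coloring sets.  To separate
-- u from v it suffices to recolor them, starting from any coloring, by two
-- incompatible colors that are compatible with their respective neighbours.
-- With a self-loop at m, color everything m and recolor u, v by two
-- non-adjacent neighbours of m; these exist unless the neighbourhood of every
-- looped vertex is a clique, which by connectivity forces H = K_q^+.  Without
-- loops, take a coloring τ with τ(u) ~ τ(v) and a gadget coloring ρ of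
-- G_{τ(u)τ(v)} separating i' from j': color u by ρ(i'), v by ρ(j') and every
-- other w by ρ(τ(w)).  Conversely G_ij and G_ij plus the edge {i',j'} are
-- distinct H-colorable graphs, so identifiability yields a coloring of G_ij
-- separating i' from j'.
module Submission where

open import Defs
open import Data.Nat using (ℕ; suc)
open import Data.Product using (_×_)
open import Relation.Nullary using (¬_)
open import Function.Bundles using (_⇔_)

open import Data.Bool using (Bool; true; false; _∧_; _∨_; T)
open import Data.Bool.Properties
  using (∨-comm; ∧-comm; ∨-zeroʳ; ¬-not; T-≡; T-∨)
  renaming (_≟_ to _≟ᵇ_)
open import Data.Empty using (⊥-elim)
open import Data.Fin using (Fin; zero; suc; _≟_; finToFun; funToFin)
open import Data.Fin.Properties using (all?; any?; finToFun-funToFin)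
open import Data.Product using (∃; _,_; proj₁)
open import Data.Sum using (_⊎_; inj₁; inj₂)
import Data.Sum as Sum
open import Data.Vec.Functional using (updateAt)
open import Data.Vec.Functional.Properties using (updateAt-updates; updateAt-minimal)
open import Function using (_∘_; const)
open import Function.Bundles using (mk⇔; Equivalence)
open import Relation.Binary.PropositionalEquality
open import Relation.Nullary using (Dec; yes; no; does)
open import Relation.Nullary.Decidable using (map′; _×-dec_; _→-dec_; dec-true; decidable-stable)

private
  variable
    q n : ℕ

true≢false : true ≢ false
true≢false ()

edge⇒≢ : (G : Graph n) {u v : Fin n} → E G u v ≡ true → u ≢ v
edge⇒≢ G {u} e refl = true≢false (trans (sym e) (Eirr G u))

-- finToFun ∘ funToFin is the identity only pointwise, hence the hypothesis on P.
any-fun? : {P : (Fin n → Fin q) → Set} →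
  (∀ {σ τ} → σ ≗ τ → P σ → P τ) → (∀ σ → Dec (P σ)) → Dec (∃ P)
any-fun? resp P? = map′
  (λ (k , p) → finToFun k , p)
  (λ (σ , p) → funToFin σ , resp (sym ∘ finToFun-funToFin σ) p)
  (any? (P? ∘ finToFun))

updateAt-const : ∀ {A : Set} (σ : Fin n → A) a u x →
  (x ≡ u × updateAt σ u (const a) x ≡ a) ⊎ (x ≢ u × updateAt σ u (const a) x ≡ σ x)
updateAt-const σ a u x with x ≟ u
... | yes refl = inj₁ (refl , updateAt-updates x σ)
... | no x≢u   = inj₂ (x≢u , updateAt-minimal x u σ x≢u)

module _ (H : ConstraintGraph q) (G : Graph n) where

  Ω? : ∀ σ → Dec (Ω H G σ)
  Ω? σ = all? λ v → all? λ w → (E G v w ≟ᵇ true) →-dec (Adj H (σ v) (σ w) ≟ᵇ true)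

  Ω-resp-≗ : ∀ {σ τ} → σ ≗ τ → Ω H G σ → Ω H G τ
  Ω-resp-≗ σ≗τ ω v w e = subst₂ (λ a b → Adj H a b ≡ true) (σ≗τ v) (σ≗τ w) (ω v w e)

  Ω-updateAt : ∀ {σ u a} → Ω H G σ →
    (∀ w → E G u w ≡ true → Adj H a (σ w) ≡ true) →
    Ω H G (updateAt σ u (const a))
  Ω-updateAt {σ} {u} {a} ω nbrs v w e with updateAt-const σ a u v | updateAt-const σ a u w
  ... | inj₁ (refl , _)     | inj₁ (refl , _)     = ⊥-elim (edge⇒≢ G e refl)
  ... | inj₁ (refl , v↦a)   | inj₂ (_ , w↦σw)   rewrite v↦a | w↦σw = nbrs w e
  ... | inj₂ (_ , v↦σv)   | inj₁ (refl , w↦a)   rewrite v↦σv | w↦a =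
    trans (symmetric H (σ v) a) (nbrs v (trans (Esym G w v) e))
  ... | inj₂ (_ , v↦σv)   | inj₂ (_ , w↦σw)   rewrite v↦σv | w↦σw = ω v w e

  separating-update : ∀ {σ u v a b} → Ω H G σ → u ≢ v → E G u v ≡ false →
    (∀ w → E G u w ≡ true → Adj H a (σ w) ≡ true) →
    (∀ w → E G v w ≡ true → Adj H b (σ w) ≡ true) →
    Adj H a b ≡ false → ∃ λ τ → Ω H G τ × Adj H (τ u) (τ v) ≡ false
  separating-update {σ} {u} {v} {a} {b} ω u≢v uv nbrsᵤ nbrsᵥ ab =
    τ , Ω-updateAt (Ω-updateAt ω nbrsᵤ) nbrsᵥ′ ,
    subst₂ (λ x y → Adj H x y ≡ false) (sym τu≡a) (sym τv≡b) ab
    where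
    σ′ = updateAt σ u (const a)
    τ  = updateAt σ′ v (const b)

    nbrsᵥ′ : ∀ w → E G v w ≡ true → Adj H b (σ′ w) ≡ true
    nbrsᵥ′ w e = subst (λ c → Adj H b c ≡ true) (sym (updateAt-minimal w u σ w≢u)) (nbrsᵥ w e)
      where
      w≢u : w ≢ u
      w≢u refl = true≢false (trans (sym e) (trans (Esym G v w) uv))

    τu≡a : τ u ≡ a
    τu≡a = trans (updateAt-minimal u v σ′ u≢v) (updateAt-updates u σ)

    τv≡b : τ v ≡ b
    τv≡b = updateAt-updates v σ′

NonEdgesSeparable : ConstraintGraph q → Set
NonEdgesSeparable H = ∀ {n} (G : Graph n) {u v} → u ≢ v → E G u v ≡ false →
  HColorable H G → ∃ λ σ → Ω H G σ × Adj H (σ u) (σ v) ≡ false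

module _ (H : ConstraintGraph q) (separable : NonEdgesSeparable H) where

  separable⇒Ω-⊈ : ∀ (G₁ G₂ : Graph n) {u v} → E G₁ u v ≡ true → E G₂ u v ≡ false →
    HColorable H G₂ → ¬ (∀ σ → Ω H G₂ σ → Ω H G₁ σ)
  separable⇒Ω-⊈ G₁ G₂ e₁ e₂ col₂ Ω₂⊆Ω₁ with separable G₂ (edge⇒≢ G₁ e₁) e₂ col₂
  ... | σ , ω₂ , incompatible =
    true≢false (trans (sym (Ω₂⊆Ω₁ σ ω₂ _ _ e₁)) incompatible)

  separable⇒edges-determined : ∀ (G₁ G₂ : Graph n) → HColorable H G₁ → HColorable H G₂ →
    (∀ σ → Ω H G₁ σ ⇔ Ω H G₂ σ) → ∀ u v → E G₁ u v ≡ E G₂ u v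
  separable⇒edges-determined G₁ G₂ col₁ col₂ same u v with E G₁ u v in e₁ | E G₂ u v in e₂
  ... | true  | true  = refl
  ... | false | false = refl
  ... | true  | false =
    ⊥-elim (separable⇒Ω-⊈ G₁ G₂ e₁ e₂ col₂ (Equivalence.from ∘ same))
  ... | false | true  =
    ⊥-elim (separable⇒Ω-⊈ G₂ G₁ e₂ e₁ col₁ (Equivalence.to ∘ same))

  separable⇒identifiable : Identifiable H
  separable⇒identifiable n G₁ G₂ col₁ col₂ G₁≢G₂ same =
    G₁≢G₂ (separable⇒edges-determined G₁ G₂ col₁ col₂ same)

module _ (H : ConstraintGraph q) where

  cliqueNeighbourhoods⇒complete : HasSelfLoop H →
    (∀ m a b → Adj H m m ≡ true → Adj H m a ≡ true → Adj H m b ≡ true → Adj H a b ≡ true) →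
    IsKqPlus H
  cliqueNeighbourhoods⇒complete (c , cc) clique i j =
    clique c i j cc (proj₁ (reach (connected H c i))) (proj₁ (reach (connected H c j)))
    where
    reach : ∀ {k} → Reachable (Adj H) c k → Adj H c k ≡ true × Adj H k k ≡ true
    reach here = cc , cc
    reach (step {j = l} r lk) with reach r
    ... | cl , ll = ck , clique c _ _ cc ck ck
      where ck = clique l c _ ll (trans (symmetric H l c) cl) lk

  nonAdjacent-neighbours-of-loop : ¬ IsKqPlus H → HasSelfLoop H →
    ∃ λ m → ∃ λ a → ∃ λ b →
      Adj H m m ≡ true × Adj H m a ≡ true × Adj H m b ≡ true × Adj H a b ≡ false
  nonAdjacent-neighbours-of-loop ¬K loop
    with any? (λ m → any? λ a → any? λ b →
           (Adj H m m ≟ᵇ true) ×-dec (Adj H m a ≟ᵇ true) ×-dec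
           (Adj H m b ≟ᵇ true) ×-dec (Adj H a b ≟ᵇ false))
  ... | yes found = found
  ... | no none = ⊥-elim (¬K (cliqueNeighbourhoods⇒complete loop λ m a b mm ma mb →
          ¬-not λ ab → none (m , a , b , mm , ma , mb , ab)))

  selfLoop⇒separable : ¬ IsKqPlus H → HasSelfLoop H → NonEdgesSeparable H
  selfLoop⇒separable ¬K loop G u≢v uv _ with nonAdjacent-neighbours-of-loop ¬K loop
  ... | m , a , b , mm , ma , mb , ab =
    separating-update H G {σ = const m} (λ _ _ _ → mm) u≢v uv
      (λ _ _ → trans (symmetric H a m) ma) (λ _ _ → trans (symmetric H b m) mb) ab

gadget⇒separable : (H : ConstraintGraph q) → GadgetCondition H → NonEdgesSeparable H
gadget⇒separable H gadget G {u} {v} u≢v uv (τ , τc) with Adj H (τ u) (τ v) in e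
... | false = τ , τc , e
... | true with gadget (τ u) (τ v) e
...   | ρ , ρc , ρi′j′ =
  separating-update H G {σ = ρ ∘ old ∘ τ} (λ x y e → ρc (old (τ x)) (old (τ y)) (τc x y e))
    u≢v uv (λ w e → ρc newi (old (τ w)) (τc u w e)) (λ w e → ρc newj (old (τ w)) (τc v w e)) ρi′j′

module _ (G : Graph n) {u v : Fin n} (u≢v : u ≢ v) where

  joins : Fin n → Fin n → Bool
  joins x y = (does (x ≟ u) ∧ does (y ≟ v)) ∨ (does (x ≟ v) ∧ does (y ≟ u))

  joins⇒endpoints : ∀ x y → joins x y ≡ true → (x ≡ u × y ≡ v) ⊎ (x ≡ v × y ≡ u)
  joins⇒endpoints x y e =
    Sum.map (both (x ≟ u) (y ≟ v)) (both (x ≟ v) (y ≟ u))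
      (Equivalence.to T-∨ (Equivalence.from T-≡ e))
    where
    both : ∀ {A B : Set} (a? : Dec A) (b? : Dec B) → T (does a? ∧ does b?) → A × B
    both (yes a) (yes b) _ = a , b
    both (yes _) (no _)  ()
    both (no _)  _       ()

  joins-sym : ∀ x y → joins x y ≡ joins y x
  joins-sym x y = trans (∨-comm (does (x ≟ u) ∧ does (y ≟ v)) _)
    (cong₂ _∨_ (∧-comm (does (x ≟ v)) _) (∧-comm (does (x ≟ u)) _))

  addEdge : Graph n
  addEdge = record
    { E    = λ x y → E G x y ∨ joins x y
    ; Esym = λ x y → cong₂ _∨_ (Esym G x y) (joins-sym x y)
    ; Eirr = λ x → cong₂ _∨_ (Eirr G x) (¬-not (joins-irr x))
    }
    where
    joins-irr : ∀ x → joins x x ≢ true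
    joins-irr x e with joins⇒endpoints x x e
    ... | inj₁ (x≡u , x≡v) = u≢v (trans (sym x≡u) x≡v)
    ... | inj₂ (x≡v , x≡u) = u≢v (trans (sym x≡u) x≡v)

  uv∈addEdge : E addEdge u v ≡ true
  uv∈addEdge rewrite dec-true (u ≟ u) refl | dec-true (v ≟ v) refl = ∨-zeroʳ (E G u v)

  Ω-addEdge : (H : ConstraintGraph q) (σ : Fin n → Fin q) →
    Ω H addEdge σ ⇔ (Ω H G σ × Adj H (σ u) (σ v) ≡ true)
  Ω-addEdge H σ = mk⇔
    (λ ω → (λ x y e → ω x y (cong (_∨ joins x y) e)) , ω u v uv∈addEdge)
    (λ (ω , σuσv) x y e → extended ω σuσv x y (E G x y) refl e)
    where
    extended : Ω H G σ → Adj H (σ u) (σ v) ≡ true →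
      ∀ x y b → E G x y ≡ b → b ∨ joins x y ≡ true → Adj H (σ x) (σ y) ≡ true
    extended ω _ x y true  exy _ = ω x y exy
    extended _ σuσv x y false _ e with joins⇒endpoints x y e
    ... | inj₁ (refl , refl) = σuσv
    ... | inj₂ (refl , refl) = trans (symmetric H (σ x) (σ y)) σuσv

module _ (H : ConstraintGraph q) (identifiable : Identifiable H) where

  identifiable⇒addable-nonEdge-separated : (G : Graph n) {u v : Fin n} (u≢v : u ≢ v) →
    E G u v ≡ false → HColorable H (addEdge G u≢v) →
    ∃ λ σ → Ω H G σ × Adj H (σ u) (σ v) ≡ false
  -- Identifiability only refutes the absence of a witness; the search over all colorings supplies it.
  identifiable⇒addable-nonEdge-separated {n} G {u} {v} u≢v uv (σ₀ , ω₀) =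
    decidable-stable (any-fun? separating-resp separating?) λ none →
      identifiable n G G⁺ (σ₀ , Ω⁺⊆Ω σ₀ ω₀) (σ₀ , ω₀) differ (same none)
    where
    G⁺ = addEdge G u≢v

    Ω⁺⊆Ω : ∀ σ → Ω H G⁺ σ → Ω H G σ
    Ω⁺⊆Ω σ = proj₁ ∘ Equivalence.to (Ω-addEdge G u≢v H σ)

    separating-resp : ∀ {σ τ} → σ ≗ τ →
      Ω H G σ × Adj H (σ u) (σ v) ≡ false → Ω H G τ × Adj H (τ u) (τ v) ≡ false
    separating-resp σ≗τ (ω , σuσv) =
      Ω-resp-≗ H G σ≗τ ω , subst₂ (λ a b → Adj H a b ≡ false) (σ≗τ u) (σ≗τ v) σuσv

    separating? : ∀ σ → Dec (Ω H G σ × Adj H (σ u) (σ v) ≡ false)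
    separating? σ = Ω? H G σ ×-dec (Adj H (σ u) (σ v) ≟ᵇ false)

    differ : ¬ (∀ x y → E G x y ≡ E G⁺ x y)
    differ same-edges = true≢false (trans (sym (uv∈addEdge G u≢v)) (trans (sym (same-edges u v)) uv))

    same : ¬ (∃ λ σ → Ω H G σ × Adj H (σ u) (σ v) ≡ false) → ∀ σ → Ω H G σ ⇔ Ω H G⁺ σ
    same none σ = mk⇔
      (λ ω → Equivalence.from (Ω-addEdge G u≢v H σ) (ω , ¬-not λ σuσv → none (σ , ω , σuσv)))
      (Ω⁺⊆Ω σ)

module Gadget (H : ConstraintGraph q) (noLoops : NoSelfLoops H) (i j : Fin q) where

  decode : Fin (suc (suc q)) → GV q
  decode zero          = newi
  decode (suc zero)    = newj
  decode (suc (suc k)) = old k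

  encode : GV q → Fin (suc (suc q))
  encode newi    = zero
  encode newj    = suc zero
  encode (old k) = suc (suc k)

  decode-encode : ∀ x → decode (encode x) ≡ x
  decode-encode newi    = refl
  decode-encode newj    = refl
  decode-encode (old k) = refl

  Gij-sym : ∀ x y → Gij H i j x y ≡ Gij H i j y x
  Gij-sym (old k) (old l) = symmetric H k l
  Gij-sym (old k) newi    = refl
  Gij-sym (old k) newj    = refl
  Gij-sym newi    (old k) = refl
  Gij-sym newi    newi    = refl
  Gij-sym newi    newj    = refl
  Gij-sym newj    (old k) = refl
  Gij-sym newj    newi    = refl
  Gij-sym newj    newj    = refl

  Gij-irr : ∀ x → Gij H i j x x ≡ false
  Gij-irr (old k) = noLoops k
  Gij-irr newi    = refl
  Gij-irr newj    = refl

  gadget : Graph (suc (suc q))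
  gadget = record
    { E    = λ x y → Gij H i j (decode x) (decode y)
    ; Esym = λ x y → Gij-sym (decode x) (decode y)
    ; Eirr = λ x → Gij-irr (decode x)
    }

  canonical : GV q → Fin q
  canonical (old k) = k
  canonical newi    = i
  canonical newj    = j

  canonical-coloring : IsHColoring H (Gij H i j) canonical
  canonical-coloring (old k) (old l) e = e
  canonical-coloring (old k) newi    e = trans (symmetric H k i) e
  canonical-coloring (old k) newj    e = trans (symmetric H k j) e
  canonical-coloring newi    (old k) e = e
  canonical-coloring newj    (old k) e = e

  i′≢j′ : encode newi ≢ encode newj
  i′≢j′ ()

  gadget⁺-colorable : Adj H i j ≡ true → HColorable H (addEdge gadget i′≢j′)
  gadget⁺-colorable ij =
    canonical ∘ decode ,
    Equivalence.from (Ω-addEdge gadget i′≢j′ H (canonical ∘ decode))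
      ((λ x y → canonical-coloring (decode x) (decode y)) , ij)

  coloring-from-gadget : ∀ {σ} → Ω H gadget σ → IsHColoring H (Gij H i j) (σ ∘ encode)
  coloring-from-gadget ω x y e =
    ω (encode x) (encode y)
      (subst₂ (λ a b → Gij H i j a b ≡ true) (sym (decode-encode x)) (sym (decode-encode y)) e)

  identifiable⇒separating-gadget-coloring : Identifiable H → Adj H i j ≡ true →
    ∃ λ ρ → IsHColoring H (Gij H i j) ρ × Adj H (ρ newi) (ρ newj) ≡ false
  identifiable⇒separating-gadget-coloring identifiable ij
    with identifiable⇒addable-nonEdge-separated H identifiable gadget i′≢j′ refl (gadget⁺-colorable ij)
  ... | σ , ω , i′≁j′ = σ ∘ encode , coloring-from-gadget ω , i′≁j′

identifiable⇒gadget : (H : ConstraintGraph q) → NoSelfLoops H → Identifiable H → GadgetCondition H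
identifiable⇒gadget H noLoops identifiable i j =
  Gadget.identifiable⇒separating-gadget-coloring H noLoops i j identifiable

theorem1 : ∀ {q : ℕ} (H : ConstraintGraph q) → ¬ IsKqPlus H →
    (HasSelfLoop H → Identifiable H) ×
    (NoSelfLoops H → (Identifiable H ⇔ GadgetCondition H))
theorem1 H ¬K =
  (λ loop → separable⇒identifiable H (selfLoop⇒separable H ¬K loop)) ,
  λ noLoops → mk⇔ (identifiable⇒gadget H noLoops)
                  (λ gadget → separable⇒identifiable H (gadget⇒separable H gadget))
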